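{- Let $a\ge 3$ be an integer. The kneading cycle containing the sequence $(a,1)$ (which is the sequence $\psi_{a,0}(x^2+(a+2)xy+ay^2)$, the principal kneading cycle of alternant $a$ and length parity $0$) consists of the sequences $$(a,1)\mapsto(1,a)\mapsto(1,a-2,1,1)\mapsto\cdots\mapsto(1,a-k,k-1,1)\mapsto\cdots\mapsto(1,1,a-2,1)\mapsto(a,1),$$ in this order under kneading, where $k$ runs from $2$ to $a-1$. In particular, every sequence in this cycle has sum of entries $a+1$.
   Context: Pinching the left end of a finite sequence of positive integers: $(x,y,z,\dots)\mapsto(1,x-1,y,z,\dots)$ if $x\ge2$, and $\mapsto(y+1,z,\dots)$ if $x=1$; the sequence $(1)$ and the empty sequence are unchanged by pinching. Pinching the right end is symmetric: $(\dots,y,x)\mapsto(\dots,y,x-1,1)$ if $x\ge2$, $\mapsto(\dots,y+1)$ if $x=1$. Kneading a sequence: remove its leftmost entry, pinch both ends of what remains, then append the removed entry at the right end. Kneading is invertible and preserves the sum of entries, so each sequence lies in a finite kneading cycle. The map $\psi_{a,0}$ sends a Zagier-reduced form $Ax^2+Bxy+Cy^2$ of discriminant $a^2+4$ to the even-length sequence of partial quotients of the simple continued fraction expansion of $\frac{(a+B)/2}{A}$. -}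

module Defs where

open import Data.Nat using (ℕ; zero; suc; _∸_)
open import Data.List using (List; []; _∷_; reverse; _++_)

-- Sequences of positive integers are represented as lists of naturals;
-- entries are assumed positive (a 0 entry at an end is left unchanged).

pinchL : List ℕ → List ℕ
pinchL []                        = []
pinchL (suc (suc m) ∷ rest)      = 1 ∷ suc m ∷ rest
pinchL (1 ∷ [])                  = 1 ∷ []
pinchL (1 ∷ y ∷ rest)            = suc y ∷ rest
pinchL (0 ∷ rest)                = 0 ∷ rest

pinchR : List ℕ → List ℕ
pinchR s = reverse (pinchL (reverse s))

knead : List ℕ → List ℕ
knead []        = []
knead (x ∷ s)   = pinchR (pinchL s) ++ (x ∷ [])

iter : {A : Set} → (A → A) → ℕ → A → A
iter f zero    x = x
iter f (suc n) x = f (iter f n x)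

cycleSeq : ℕ → ℕ → List ℕ
cycleSeq a zero          = a ∷ 1 ∷ []
cycleSeq a (suc zero)    = 1 ∷ a ∷ []
cycleSeq a (suc (suc j)) = 1 ∷ (a ∸ suc (suc j)) ∷ suc j ∷ 1 ∷ []

module Submission where

-- Kneading acts on the sequences appearing in the claimed cycle by four
-- local rules, each a definitional computation:
--   (a,1) ↦ (1,a),   (1,m+3) ↦ (1,m+1,1,1),
--   (1,m+2,j+1,1) ↦ (1,m+1,j+2,1),   (1,1,j+1,1) ↦ (j+3,1).
-- With one fact about truncated subtraction these give the single step
-- knead (cycleSeq a i) ≡ cycleSeq a (i+1) for i+1 < a, and the closing step
-- knead (cycleSeq a (a-1)) ≡ cycleSeq a 0.  Induction on i identifies the
-- orbit of (a,1) with cycleSeq, and the closing step shows the orbit returns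
-- to (a,1) after a kneadings.  Distinctness of the listed sequences follows
-- from an explicit left inverse  cycleIndex  of  cycleSeq a, and the sums of
-- entries are a direct computation.

open import Defs
open import Data.Nat using (ℕ; zero; suc; _≤_; _<_; _+_; _∸_; s≤s)
open import Data.Nat.Properties using (+-∸-assoc; m+n∸n≡m; m∸n+n≡m; +-comm; <⇒≤; n<1+n; <-trans)
open import Data.List using (List; []; _∷_)
open import Data.Nat.ListAction using (sum)
open import Data.Product using (_×_; _,_)
open import Relation.Binary.PropositionalEquality
  using (_≡_; refl; sym; cong; module ≡-Reasoning)
open ≡-Reasoning

-- Below the top, n ∸ j is the successor of n ∸ (j+1).  This exposes the
-- positive second entry a ∸ i of cycleSeq a i to the kneading rules.
∸-unfold : ∀ {n j} → j < n → n ∸ j ≡ suc (n ∸ suc j)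
∸-unfold {suc n} (s≤s j≤n) = +-∸-assoc 1 j≤n

knead-swap : ∀ a → knead (a ∷ 1 ∷ []) ≡ 1 ∷ a ∷ []
knead-swap a = refl

knead-split : ∀ m → knead (1 ∷ suc (suc (suc m)) ∷ []) ≡ 1 ∷ suc m ∷ 1 ∷ 1 ∷ []
knead-split m = refl

knead-shift : ∀ m j →
  knead (1 ∷ suc (suc m) ∷ suc j ∷ 1 ∷ []) ≡ 1 ∷ suc m ∷ suc (suc j) ∷ 1 ∷ []
knead-shift m j = refl

knead-collapse : ∀ j → knead (1 ∷ 1 ∷ suc j ∷ 1 ∷ []) ≡ suc (suc (suc j)) ∷ 1 ∷ []
knead-collapse j = refl

knead-step : ∀ a i → 3 ≤ a → suc i < a → knead (cycleSeq a i) ≡ cycleSeq a (suc i)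
knead-step a zero _ _ = knead-swap a
-- (for i = 1 the proof of 3 ≤ a exhibits a as n + 3, so a ∸ 2 is n + 1)
knead-step _ (suc zero) (s≤s (s≤s (s≤s {n = n} _))) _ = knead-split n
knead-step a (suc (suc j)) _ j+3<a = begin
  knead (1 ∷ a ∸ suc (suc j) ∷ suc j ∷ 1 ∷ [])
    ≡⟨ cong (λ x → knead (1 ∷ x ∷ suc j ∷ 1 ∷ [])) second-entry ⟩
  knead (1 ∷ suc (suc m) ∷ suc j ∷ 1 ∷ [])
    ≡⟨ knead-shift m j ⟩
  1 ∷ suc m ∷ suc (suc j) ∷ 1 ∷ []
    ≡⟨ cong (λ x → 1 ∷ x ∷ suc (suc j) ∷ 1 ∷ []) (sym (∸-unfold j+3<a)) ⟩
  1 ∷ a ∸ suc (suc (suc j)) ∷ suc (suc j) ∷ 1 ∷ []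
    ∎
  where
  m : ℕ
  m = a ∸ suc (suc (suc (suc j)))

  second-entry : a ∸ suc (suc j) ≡ suc (suc m)
  second-entry = begin
    a ∸ suc (suc j)               ≡⟨ ∸-unfold (<-trans (n<1+n _) j+3<a) ⟩
    suc (a ∸ suc (suc (suc j)))   ≡⟨ cong suc (∸-unfold j+3<a) ⟩
    suc (suc m)                   ∎

knead-close : ∀ j →
  knead (cycleSeq (suc (suc (suc j))) (suc (suc j))) ≡ cycleSeq (suc (suc (suc j))) 0
knead-close j = begin
  knead (1 ∷ suc j ∸ j ∷ suc j ∷ 1 ∷ [])
    ≡⟨ cong (λ x → knead (1 ∷ x ∷ suc j ∷ 1 ∷ [])) (m+n∸n≡m 1 j) ⟩
  knead (1 ∷ 1 ∷ suc j ∷ 1 ∷ [])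
    ≡⟨ knead-collapse j ⟩
  suc (suc (suc j)) ∷ 1 ∷ []
    ∎

orbit : ∀ a → 3 ≤ a → ∀ i → i < a → iter knead i (a ∷ 1 ∷ []) ≡ cycleSeq a i
orbit a _   zero    _     = refl
orbit a 3≤a (suc i) i+1<a = begin
  knead (iter knead i (a ∷ 1 ∷ []))  ≡⟨ cong knead (orbit a 3≤a i (<-trans (n<1+n i) i+1<a)) ⟩
  knead (cycleSeq a i)               ≡⟨ knead-step a i 3≤a i+1<a ⟩
  cycleSeq a (suc i)                 ∎

period : ∀ a → 3 ≤ a → iter knead a (a ∷ 1 ∷ []) ≡ a ∷ 1 ∷ []
period a@(suc (suc (suc j))) 3≤a@(s≤s (s≤s (s≤s _))) = begin
  knead (iter knead (suc (suc j)) (a ∷ 1 ∷ []))  ≡⟨ cong knead (orbit a 3≤a (suc (suc j)) (n<1+n _)) ⟩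
  knead (cycleSeq a (suc (suc j)))               ≡⟨ knead-close j ⟩
  a ∷ 1 ∷ []                                     ∎

cycleIndex : List ℕ → ℕ
cycleIndex (_ ∷ _ ∷ x ∷ _ ∷ []) = suc x
cycleIndex (1 ∷ _ ∷ [])         = 1
cycleIndex _                    = 0

-- cycleIndex is a left inverse of cycleSeq a as soon as a ≥ 2, where (a,1)
-- and (1,a) become distinguishable.
cycleIndex-cycleSeq : ∀ n i → cycleIndex (cycleSeq (suc (suc n)) i) ≡ i
cycleIndex-cycleSeq n zero          = refl
cycleIndex-cycleSeq n (suc zero)    = refl
cycleIndex-cycleSeq n (suc (suc j)) = refl

cycleSeq-injective : ∀ a → 2 ≤ a → ∀ i j → cycleSeq a i ≡ cycleSeq a j → i ≡ j
cycleSeq-injective (suc (suc n)) (s≤s (s≤s _)) i j eq = begin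
  i                                     ≡⟨ sym (cycleIndex-cycleSeq n i) ⟩
  cycleIndex (cycleSeq (suc (suc n)) i) ≡⟨ cong cycleIndex eq ⟩
  cycleIndex (cycleSeq (suc (suc n)) j) ≡⟨ cycleIndex-cycleSeq n j ⟩
  j                                     ∎

cycleSeq-sum : ∀ a i → i < a → sum (cycleSeq a i) ≡ suc a
cycleSeq-sum a zero          _     = +-comm a 1
cycleSeq-sum a (suc zero)    _     = cong suc (+-comm a 0)
cycleSeq-sum a (suc (suc j)) j+2<a = cong suc (begin
  a ∸ suc (suc j) + (suc j + 1)  ≡⟨ cong (a ∸ suc (suc j) +_) (+-comm (suc j) 1) ⟩
  a ∸ suc (suc j) + suc (suc j)  ≡⟨ m∸n+n≡m (<⇒≤ j+2<a) ⟩
  a                              ∎)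

lemma1 : (a : ℕ) → 3 ≤ a →
    ((i : ℕ) → i < a → iter knead i (a ∷ 1 ∷ []) ≡ cycleSeq a i)
    × iter knead a (a ∷ 1 ∷ []) ≡ (a ∷ 1 ∷ [])
    × ((i j : ℕ) → i < a → j < a → cycleSeq a i ≡ cycleSeq a j → i ≡ j)
    × ((i : ℕ) → i < a → sum (cycleSeq a i) ≡ suc a)
lemma1 a 3≤a =
    orbit a 3≤a
  , period a 3≤a
  , (λ i j _ _ → cycleSeq-injective a (<⇒≤ 3≤a) i j)
  , cycleSeq-sum a
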